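{- For any two compositions $I$ and $J$ (with their last part greater than $1$), $\mathsf{H}_I \cdot \mathsf{H}_J = \sum_{K \in \mathrm{Sh}(I,J)} \mathsf{H}_K$, where $\mathrm{Sh}(I,J)$ denotes the multiset of compositions obtained by shuffling the parts of $I$ and $J$.
   Context: The multiset of shuffles of compositions $I=(i_1,\dots,i_r)$ and $J=(j_1,\dots,j_s)$ is defined recursively by $\mathrm{Sh}(I,J)=(i_1)\cdot\mathrm{Sh}((i_2,\dots,i_r),J)\ \sqcup\ (j_1)\cdot\mathrm{Sh}(I,(j_2,\dots,j_s))$, where $\cdot$ is concatenation. Let $p_1,p_2,\dots$, $q_1,q_2,\dots$ be commuting variables (multirectangular coordinates) and $q'_i=q_i+q_{i+1}+\cdots$. For a composition $I$ with last part greater than $1$, $\mathsf{H}_I=\sum_{s\ge1}\sum_{\substack{I=I_1\cdot I_2\cdots I_s\\ k_1<\dots<k_s}}\prod_t \frac{p_{k_t}^{\ell(I_t)}(q'_{k_t})^{|I_t|-\ell(I_t)}}{\ell(I_t)!}$, the inner sum over ways of writing $I$ as a concatenation of $s$ nonempty compositions and increasing sequences of indices; here $\ell$ is the number of parts and $|\cdot|$ the sum of parts. These $\mathsf{H}_I$ form a basis of the algebra of polynomials in the $p_i,q_i$ whose value depends only on the Young diagram with multirectangular coordinates $(\bm p,\bm q)$. -}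

module Defs where

open import Data.Nat as ℕ using (ℕ; zero; suc; _!; _≤?_)
open import Data.Nat.Properties using (_!≢0)
open import Data.Integer using (+_)
open import Data.Rational using (ℚ; 0ℚ; 1ℚ; _+_; _*_; _/_)
open import Data.List using (List; []; _∷_; [_]; map; _++_; concatMap; foldr; length; upTo; filter; zipWith)

-- A composition is a list of positive natural numbers.
Composition : Set
Composition = List ℕ

size : Composition → ℕ
size = foldr ℕ._+_ 0

shuffles : Composition → Composition → List Composition
shuffles [] J = [ J ]
shuffles (i ∷ I) [] = [ i ∷ I ]
shuffles (i ∷ I) (j ∷ J) =
  map (i ∷_) (shuffles I (j ∷ J)) ++ map (j ∷_) (shuffles (i ∷ I) J)

-- All ways of writing I = I₁ · I₂ ⋯ I_s with s ≥ 1 and every Iₜ nonempty.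
private
  addToFirst : ℕ → List Composition → List Composition
  addToFirst x [] = [ [ x ] ]
  addToFirst x (c ∷ cs) = (x ∷ c) ∷ cs

decompositions : Composition → List (List Composition)
decompositions [] = []
decompositions (x ∷ []) = [ [ [ x ] ] ]
decompositions (x ∷ y ∷ ys) =
  map (addToFirst x) (decompositions (y ∷ ys))
  ++ map ([ x ] ∷_) (decompositions (y ∷ ys))

-- strictly increasing sequences of length s with values in {lo, lo+1, …, lo+n-1}
incSeqsFrom : ℕ → ℕ → ℕ → List (List ℕ)
incSeqsFrom zero lo n = [ [] ]
incSeqsFrom (suc s) lo zero = []
incSeqsFrom (suc s) lo (suc n) =
  map (lo ∷_) (incSeqsFrom s (suc lo) n) ++ incSeqsFrom (suc s) (suc lo) n

incSeqs : ℕ → ℕ → List (List ℕ)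
incSeqs s d = incSeqsFrom s 1 d

sumℚ : List ℚ → ℚ
sumℚ = foldr _+_ 0ℚ

prodℚ : List ℚ → ℚ
prodℚ = foldr _*_ 1ℚ

powℚ : ℚ → ℕ → ℚ
powℚ x zero = 1ℚ
powℚ x (suc n) = x * powℚ x n

-- q'_k = q_k + q_{k+1} + ⋯ + q_d   (the coordinates are p_1..p_d, q_1..q_d)
q′ : ℕ → (ℕ → ℚ) → ℕ → ℚ
q′ d q k = sumℚ (map q (filter (k ≤?_) (upTo (suc d))))

factor : ℕ → (ℕ → ℚ) → (ℕ → ℚ) → Composition → ℕ → ℚ
factor d p q P k =
  powℚ (p k) (length P) * powℚ (q′ d q k) (size P ℕ.∸ length P)
    * ((+ 1) / (length P) !) {{(length P) !≢0}}

-- H_I evaluated at multirectangular coordinates (p_1..p_d, q_1..q_d)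
H : ℕ → (ℕ → ℚ) → (ℕ → ℚ) → Composition → ℚ
H d p q I =
  sumℚ (concatMap
    (λ D → map (λ ks → prodℚ (zipWith (factor d p q) D ks)) (incSeqs (length D) d))
    (decompositions I))

-- Write H_I as the sum, over all ways of cutting I into d consecutive and
-- possibly empty pieces, of products in which the k-th piece E weighs
-- p_k^ℓ(E) q'_k^(|E|−ℓ(E)) / ℓ(E)!.  For a single k this weight is
-- multiplicative for the shuffle product: all shuffles of A and C have the
-- same length and size, and there are (ℓA+ℓC)!/(ℓA! ℓC!) of them.
-- Multiplicativity passes to the sum over all cuttings because deconcatenation
-- is a morphism for the shuffle product, Δ(I ⧢ J) = Δ I ⧢ Δ J.
module Submission where

open import Defs
open import Algebra.Bundles using (CommutativeMonoid)
import Algebra.Properties.CommutativeSemigroup as CommSemigroupProperties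
import Data.Integer as ℤ
import Data.Integer.Properties as ℤₚ
open import Data.List using (List; []; _∷_; [_]; map; _++_; concatMap; length; zipWith)
import Data.List.Properties as List
open import Data.List.Relation.Binary.Permutation.Propositional
  using (_↭_; prep; ↭-refl; ↭-trans; ↭-sym)
open import Data.List.Relation.Binary.Permutation.Propositional.Properties
  using (shift; ↭-length; map⁺; All-resp-↭)
open import Data.List.Relation.Unary.All using (All; []; _∷_)
import Data.List.Relation.Unary.All as All
import Data.List.Relation.Unary.All.Properties as All
open import Data.Maybe using (nothing)
open import Data.Nat as ℕ using (ℕ; zero; suc; _!; _∸_; _≤_; _<_; s≤s; z≤n)
open import Data.Nat.Coprimality using (1-coprimeTo)
import Data.Nat.Coprimality as Coprimality
open import Data.Nat.ListAction using (sum)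
open import Data.Nat.ListAction.Properties using (sum-↭; sum-++)
import Data.Nat.Properties as ℕₚ
open import Data.Nat.Tactic.RingSolver using () renaming (solve-∀ to ℕ-solve-∀)
open import Data.Product using (Σ; _×_; _,_; proj₁; proj₂; map₁; uncurry)
open import Data.Rational using (ℚ; 0ℚ; 1ℚ; _+_; _*_; _/_)
open import Data.Rational.Literals using (fromℤ)
open import Data.Rational.Properties
open import Function using (_∘_)
open import Relation.Binary.PropositionalEquality
  using (_≡_; _≢_; refl; sym; trans; cong; cong₂; subst; module ≡-Reasoning)
open import Relation.Nullary using (contradiction)
import Tactic.RingSolver.Core.AlmostCommutativeRing as ACR
open import Tactic.RingSolver using (solve-∀)

open ≡-Reasoning
open CommSemigroupProperties (CommutativeMonoid.commutativeSemigroup +-0-commutativeMonoid)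
  using () renaming (interchange to +-interchange)
open CommSemigroupProperties (CommutativeMonoid.commutativeSemigroup *-1-commutativeMonoid)
  using () renaming (interchange to *-interchange)

ℚ-ring : ACR.AlmostCommutativeRing _ _
ℚ-ring = ACR.fromCommutativeRing +-*-commutativeRing (λ _ → nothing)

ι : ℕ → ℚ
ι n = fromℤ (ℤ.+ n)

+n/1≡ι : ∀ n → ℤ.+ n / 1 ≡ ι n
+n/1≡ι n = normalize-coprime (Coprimality.sym (1-coprimeTo n))

ι-+ : ∀ m n → ι (m ℕ.+ n) ≡ ι m + ι n
ι-+ m n = sym (trans (/-cong numerator refl) (+n/1≡ι (m ℕ.+ n)))
  where
  numerator : ℤ.+ m ℤ.* ℤ.+ 1 ℤ.+ ℤ.+ n ℤ.* ℤ.+ 1 ≡ ℤ.+ (m ℕ.+ n)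
  numerator = trans (cong₂ ℤ._+_ (ℤₚ.*-identityʳ (ℤ.+ m)) (ℤₚ.*-identityʳ (ℤ.+ n)))
                    (sym (ℤₚ.pos-+ m n))

ι-* : ∀ m n → ι (m ℕ.* n) ≡ ι m * ι n
ι-* m n = sym (trans (/-cong (sym (ℤₚ.pos-* m n)) refl) (+n/1≡ι (m ℕ.* n)))

1/n*n≡1 : ∀ n .{{_ : ℕ.NonZero n}} → (ℤ.+ 1 / n) * ι n ≡ 1ℚ
1/n*n≡1 (suc m) =
  trans (cong (_* ι (suc m)) (normalize-coprime (1-coprimeTo (suc m)))) (*-inverseˡ (ι (suc m)))

1/_! : ℕ → ℚ
1/ n ! = (ℤ.+ 1 / n !) {{n ℕₚ.!≢0}}

1/n!*n!≡1 : ∀ n → 1/ n ! * ι (n !) ≡ 1ℚ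
1/n!*n!≡1 n = 1/n*n≡1 (n !) {{n ℕₚ.!≢0}}

1/[l+m]!-binomial : ∀ N l m → N ℕ.* (l ! ℕ.* m !) ≡ (l ℕ.+ m) ! →
  ι N * 1/ (l ℕ.+ m) ! ≡ 1/ l ! * 1/ m !
1/[l+m]!-binomial N l m N*l!*m!≡[l+m]! = begin
  ι N * r
    ≡⟨ *-identityʳ (ι N * r) ⟨
  ι N * r * 1ℚ
    ≡⟨ cong (ι N * r *_) (cong₂ _*_ (1/n!*n!≡1 l) (1/n!*n!≡1 m)) ⟨
  ι N * r * ((1/ l ! * ι (l !)) * (1/ m ! * ι (m !)))
    ≡⟨ regroup (ι N) r (1/ l !) (1/ m !) (ι (l !)) (ι (m !)) ⟩
  ι N * (ι (l !) * ι (m !)) * r * (1/ l ! * 1/ m !)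
    ≡⟨ cong (λ x → x * r * (1/ l ! * 1/ m !)) ιN*l!*m!≡ι[l+m]! ⟩
  ι ((l ℕ.+ m) !) * r * (1/ l ! * 1/ m !)
    ≡⟨ cong (_* (1/ l ! * 1/ m !)) (trans (*-comm _ r) (1/n!*n!≡1 (l ℕ.+ m))) ⟩
  1ℚ * (1/ l ! * 1/ m !)
    ≡⟨ *-identityˡ _ ⟩
  1/ l ! * 1/ m ! ∎
  where
  r = 1/ (l ℕ.+ m) !
  ιN*l!*m!≡ι[l+m]! : ι N * (ι (l !) * ι (m !)) ≡ ι ((l ℕ.+ m) !)
  ιN*l!*m!≡ι[l+m]! = begin
    ι N * (ι (l !) * ι (m !)) ≡⟨ cong (ι N *_) (ι-* (l !) (m !)) ⟨
    ι N * ι (l ! ℕ.* m !)     ≡⟨ ι-* N _ ⟨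
    ι (N ℕ.* (l ! ℕ.* m !))   ≡⟨ cong ι N*l!*m!≡[l+m]! ⟩
    ι ((l ℕ.+ m) !) ∎
  regroup : ∀ a b x y u v → a * b * ((x * u) * (y * v)) ≡ a * (u * v) * b * (x * y)
  regroup = solve-∀ ℚ-ring

powℚ-+ : ∀ a m n → powℚ a (m ℕ.+ n) ≡ powℚ a m * powℚ a n
powℚ-+ a zero    n = sym (*-identityˡ (powℚ a n))
powℚ-+ a (suc m) n = trans (cong (a *_) (powℚ-+ a m n)) (sym (*-assoc a (powℚ a m) (powℚ a n)))

∑ : {A : Set} → (A → ℚ) → List A → ℚ
∑ f xs = sumℚ (map f xs)

sumℚ-++ : ∀ xs ys → sumℚ (xs ++ ys) ≡ sumℚ xs + sumℚ ys
sumℚ-++ []       ys = sym (+-identityˡ _)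
sumℚ-++ (x ∷ xs) ys = trans (cong (x +_) (sumℚ-++ xs ys)) (sym (+-assoc x _ _))

sumℚ-concatMap : {A : Set} (f : A → List ℚ) (xs : List A) →
  sumℚ (concatMap f xs) ≡ ∑ (sumℚ ∘ f) xs
sumℚ-concatMap f []       = refl
sumℚ-concatMap f (x ∷ xs) =
  trans (sumℚ-++ (f x) _) (cong (sumℚ (f x) +_) (sumℚ-concatMap f xs))

∑-++ : {A : Set} (f : A → ℚ) (xs ys : List A) → ∑ f (xs ++ ys) ≡ ∑ f xs + ∑ f ys
∑-++ f xs ys = trans (cong sumℚ (List.map-++ f xs ys)) (sumℚ-++ (map f xs) _)

∑-map : {A B : Set} (f : B → ℚ) (g : A → B) (xs : List A) → ∑ f (map g xs) ≡ ∑ (f ∘ g) xs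
∑-map f g xs = cong sumℚ (sym (List.map-∘ xs))

∑-cong : {A : Set} {f g : A → ℚ} → (∀ x → f x ≡ g x) → ∀ xs → ∑ f xs ≡ ∑ g xs
∑-cong f≗g xs = cong sumℚ (List.map-cong f≗g xs)

∑-cong-All : {A : Set} {P : A → Set} {f g : A → ℚ} →
  (∀ {x} → P x → f x ≡ g x) → ∀ {xs} → All P xs → ∑ f xs ≡ ∑ g xs
∑-cong-All f≗g []         = refl
∑-cong-All f≗g (px ∷ pxs) = cong₂ _+_ (f≗g px) (∑-cong-All f≗g pxs)

∑-+ : {A : Set} (f g : A → ℚ) (xs : List A) → ∑ (λ x → f x + g x) xs ≡ ∑ f xs + ∑ g xs
∑-+ f g []       = refl
∑-+ f g (x ∷ xs) =
  trans (cong (f x + g x +_) (∑-+ f g xs)) (+-interchange (f x) (g x) _ _)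

*-distribˡ-∑ : {A : Set} (c : ℚ) (f : A → ℚ) (xs : List A) →
  c * ∑ f xs ≡ ∑ (λ x → c * f x) xs
*-distribˡ-∑ c f []       = *-zeroʳ c
*-distribˡ-∑ c f (x ∷ xs) =
  trans (*-distribˡ-+ c (f x) _) (cong (c * f x +_) (*-distribˡ-∑ c f xs))

*-distribʳ-∑ : {A : Set} (c : ℚ) (f : A → ℚ) (xs : List A) →
  ∑ f xs * c ≡ ∑ (λ x → f x * c) xs
*-distribʳ-∑ c f []       = *-zeroˡ c
*-distribʳ-∑ c f (x ∷ xs) =
  trans (*-distribʳ-+ c (f x) _) (cong (f x * c +_) (*-distribʳ-∑ c f xs))

∑-*-∑ : {A B : Set} (f : A → ℚ) (g : B → ℚ) (xs : List A) (ys : List B) →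
  ∑ f xs * ∑ g ys ≡ ∑ (λ x → ∑ (λ y → f x * g y) ys) xs
∑-*-∑ f g xs ys =
  trans (*-distribʳ-∑ (∑ g ys) f xs) (∑-cong (λ x → *-distribˡ-∑ (f x) g ys) xs)

∑-const : {A : Set} (c : ℚ) (xs : List A) → ∑ (λ _ → c) xs ≡ ι (length xs) * c
∑-const c []       = sym (*-zeroˡ c)
∑-const c (x ∷ xs) = begin
  c + ∑ (λ _ → c) xs          ≡⟨ cong (c +_) (∑-const c xs) ⟩
  c + ι (length xs) * c       ≡⟨ cong (_+ ι (length xs) * c) (*-identityˡ c) ⟨
  1ℚ * c + ι (length xs) * c  ≡⟨ *-distribʳ-+ c 1ℚ (ι (length xs)) ⟨
  (1ℚ + ι (length xs)) * c    ≡⟨ cong (_* c) (ι-+ 1 (length xs)) ⟨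
  ι (suc (length xs)) * c ∎

∑-zero : {A : Set} (xs : List A) → ∑ (λ _ → 0ℚ) xs ≡ 0ℚ
∑-zero xs = trans (∑-const 0ℚ xs) (*-zeroʳ (ι (length xs)))

shuffles-[]ʳ : ∀ A → shuffles A [] ≡ [ A ]
shuffles-[]ʳ []      = refl
shuffles-[]ʳ (_ ∷ _) = refl

∑-shuffles-[]ʳ : ∀ (f : Composition → ℚ) A → ∑ f (shuffles A []) ≡ f A
∑-shuffles-[]ʳ f A = trans (cong (∑ f) (shuffles-[]ʳ A)) (+-identityʳ (f A))

∑-shuffles-∷∷ : ∀ (f : Composition → ℚ) i A j C →
  ∑ f (shuffles (i ∷ A) (j ∷ C)) ≡
  ∑ (f ∘ (i ∷_)) (shuffles A (j ∷ C)) + ∑ (f ∘ (j ∷_)) (shuffles (i ∷ A) C)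
∑-shuffles-∷∷ f i A j C =
  trans (∑-++ f (map (i ∷_) (shuffles A (j ∷ C))) _)
        (cong₂ _+_ (∑-map f (i ∷_) (shuffles A (j ∷ C))) (∑-map f (j ∷_) (shuffles (i ∷ A) C)))

shuffles-↭ : ∀ A C → All (_↭ A ++ C) (shuffles A C)
shuffles-↭ []      C       = ↭-refl ∷ []
shuffles-↭ (i ∷ A) []      = subst (i ∷ A ↭_) (sym (List.++-identityʳ (i ∷ A))) ↭-refl ∷ []
shuffles-↭ (i ∷ A) (j ∷ C) = All.++⁺
  (All.map⁺ (All.map (prep i) (shuffles-↭ A (j ∷ C))))
  (All.map⁺ (All.map (λ E↭ → ↭-trans (prep j E↭) (↭-sym (shift j (i ∷ A) C)))
                      (shuffles-↭ (i ∷ A) C)))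

shuffles-All : {P : ℕ → Set} {A C : Composition} →
  All P A → All P C → All (All P) (shuffles A C)
shuffles-All {A = A} {C} pA pC =
  All.map (λ E↭ → All-resp-↭ (↭-sym E↭) (All.++⁺ pA pC)) (shuffles-↭ A C)

shuffles-≢[] : ∀ {I} J → I ≢ [] → All (_≢ []) (shuffles I J)
shuffles-≢[] {[]}    J       I≢[] = contradiction refl I≢[]
shuffles-≢[] {i ∷ I} []      _    = (λ ()) ∷ []
shuffles-≢[] {i ∷ I} (j ∷ J) _    =
  All.++⁺ (All.map⁺ {f = i ∷_} (All.universal (λ _ ()) (shuffles I (j ∷ J))))
          (All.map⁺ {f = j ∷_} (All.universal (λ _ ()) (shuffles (i ∷ I) J)))

length-shuffles : ∀ A C →
  length (shuffles A C) ℕ.* (length A ! ℕ.* length C !) ≡ (length A ℕ.+ length C) !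
length-shuffles []      C       = trans (ℕₚ.*-identityˡ _) (ℕₚ.*-identityˡ _)
length-shuffles (i ∷ A) []      = trans (ℕₚ.*-identityˡ _)
  (trans (ℕₚ.*-identityʳ _) (cong _! (sym (ℕₚ.+-identityʳ (length (i ∷ A))))))
length-shuffles (i ∷ A) (j ∷ C) = begin
  length (map (i ∷_) X ++ map (j ∷_) Y) ℕ.* (suc a ! ℕ.* suc c !)
    ≡⟨ cong (ℕ._* (suc a ! ℕ.* suc c !)) lengthX+lengthY ⟩
  (length X ℕ.+ length Y) ℕ.* (suc a ! ℕ.* suc c !)
    ≡⟨ regroup (length X) (length Y) a c (a !) (c !) ⟩
  suc a ℕ.* (length X ℕ.* (a ! ℕ.* suc c !)) ℕ.+ suc c ℕ.* (length Y ℕ.* (suc a ! ℕ.* c !))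
    ≡⟨ cong₂ (λ x y → suc a ℕ.* x ℕ.+ suc c ℕ.* y)
             (length-shuffles A (j ∷ C)) (length-shuffles (i ∷ A) C) ⟩
  suc a ℕ.* (a ℕ.+ suc c) ! ℕ.+ suc c ℕ.* (suc a ℕ.+ c) !
    ≡⟨ cong (λ n → suc a ℕ.* (a ℕ.+ suc c) ! ℕ.+ suc c ℕ.* n !) (ℕₚ.+-suc a c) ⟨
  suc a ℕ.* (a ℕ.+ suc c) ! ℕ.+ suc c ℕ.* (a ℕ.+ suc c) !
    ≡⟨ ℕₚ.*-distribʳ-+ ((a ℕ.+ suc c) !) (suc a) (suc c) ⟨
  (suc a ℕ.+ suc c) ! ∎
  where
  a = length A
  c = length C
  X = shuffles A (j ∷ C)
  Y = shuffles (i ∷ A) C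
  lengthX+lengthY : length (map (i ∷_) X ++ map (j ∷_) Y) ≡ length X ℕ.+ length Y
  lengthX+lengthY = trans (List.length-++ (map (i ∷_) X))
    (cong₂ ℕ._+_ (List.length-map (i ∷_) X) (List.length-map (j ∷_) Y))
  regroup : ∀ x y a c u v → (x ℕ.+ y) ℕ.* ((suc a ℕ.* u) ℕ.* (suc c ℕ.* v)) ≡
    suc a ℕ.* (x ℕ.* (u ℕ.* (suc c ℕ.* v))) ℕ.+ suc c ℕ.* (y ℕ.* ((suc a ℕ.* u) ℕ.* v))
  regroup = ℕ-solve-∀

-- Deconcatenation

splits : {A : Set} → List A → List (List A × List A)
splits []       = [ ([] , []) ]
splits (x ∷ xs) = ([] , x ∷ xs) ∷ map (map₁ (x ∷_)) (splits xs)

splits-++ : {A : Set} (xs : List A) → All (λ (P , S) → P ++ S ≡ xs) (splits xs)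
splits-++ []       = refl ∷ []
splits-++ (x ∷ xs) = refl ∷ All.map⁺ (All.map (cong (x ∷_)) (splits-++ xs))

∑-splits-∷ : {A : Set} (f : List A × List A → ℚ) (x : A) (xs : List A) →
  ∑ f (splits (x ∷ xs)) ≡ f ([] , x ∷ xs) + ∑ (λ (P , S) → f (x ∷ P , S)) (splits xs)
∑-splits-∷ f x xs = cong (f ([] , x ∷ xs) +_) (∑-map f (map₁ (x ∷_)) (splits xs))

-- A function g of two compositions is read as the linear form E ⊗ M ↦ g E M;
-- Δ g K pairs it with the deconcatenation coproduct Δ K = ∑_{K = E·M} E ⊗ M,
-- and shuffle⊗ g with the shuffle product of tensors, (A ⊗ B) ⧢ (C ⊗ D).

Δ : (Composition → Composition → ℚ) → Composition → ℚ
Δ g K = ∑ (uncurry g) (splits K)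

shuffle⊗ : (Composition → Composition → ℚ) →
  Composition × Composition → Composition × Composition → ℚ
shuffle⊗ g (A , B) (C , D) = ∑ (λ E → ∑ (g E) (shuffles B D)) (shuffles A C)

Δ⧢Δ : (Composition → Composition → ℚ) → Composition → Composition → ℚ
Δ⧢Δ g I J = ∑ (λ AB → ∑ (shuffle⊗ g AB) (splits J)) (splits I)

∑Δ-shuffles-∷∷ : ∀ g i I j J →
  ∑ (Δ g) (shuffles (i ∷ I) (j ∷ J)) ≡
  ∑ (g []) (shuffles (i ∷ I) (j ∷ J)) +
  (∑ (Δ (g ∘ (i ∷_))) (shuffles I (j ∷ J)) + ∑ (Δ (g ∘ (j ∷_))) (shuffles (i ∷ I) J))
∑Δ-shuffles-∷∷ g i I j J = begin
  ∑ (Δ g) (shuffles (i ∷ I) (j ∷ J))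
    ≡⟨ ∑-shuffles-∷∷ (Δ g) i I j J ⟩
  ∑ (Δ g ∘ (i ∷_)) X + ∑ (Δ g ∘ (j ∷_)) Y
    ≡⟨ cong₂ _+_ (∑-cong (∑-splits-∷ (uncurry g) i) X) (∑-cong (∑-splits-∷ (uncurry g) j) Y) ⟩
  ∑ (λ K → g [] (i ∷ K) + Δ (g ∘ (i ∷_)) K) X + ∑ (λ K → g [] (j ∷ K) + Δ (g ∘ (j ∷_)) K) Y
    ≡⟨ cong₂ _+_ (∑-+ _ _ X) (∑-+ _ _ Y) ⟩
  (x₀ + x₁) + (y₀ + y₁)
    ≡⟨ +-interchange x₀ x₁ y₀ y₁ ⟩
  (x₀ + y₀) + (x₁ + y₁)
    ≡⟨ cong (_+ (x₁ + y₁)) (∑-shuffles-∷∷ (g []) i I j J) ⟨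
  ∑ (g []) (shuffles (i ∷ I) (j ∷ J)) + (x₁ + y₁) ∎
  where
  X = shuffles I (j ∷ J)
  Y = shuffles (i ∷ I) J
  x₀ = ∑ (g [] ∘ (i ∷_)) X
  x₁ = ∑ (Δ (g ∘ (i ∷_))) X
  y₀ = ∑ (g [] ∘ (j ∷_)) Y
  y₁ = ∑ (Δ (g ∘ (j ∷_))) Y

shuffle⊗-[]ˡ : ∀ g CD → shuffle⊗ g ([] , []) CD ≡ uncurry g CD
shuffle⊗-[]ˡ g (C , D) = trans (+-identityʳ _) (+-identityʳ (g C D))

shuffle⊗-[]ʳ : ∀ g AB → shuffle⊗ g AB ([] , []) ≡ uncurry g AB
shuffle⊗-[]ʳ g (A , B) =
  trans (∑-shuffles-[]ʳ (λ E → ∑ (g E) (shuffles B [])) A) (∑-shuffles-[]ʳ (g A) B)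

∑shuffle⊗-∷ : ∀ g i A B j J →
  ∑ (shuffle⊗ g (i ∷ A , B)) (splits (j ∷ J)) ≡
  ∑ (shuffle⊗ (g ∘ (i ∷_)) (A , B)) (splits (j ∷ J)) +
  ∑ (shuffle⊗ (g ∘ (j ∷_)) (i ∷ A , B)) (splits J)
∑shuffle⊗-∷ g i A B j J = begin
  ∑ (shuffle⊗ g (i ∷ A , B)) (splits (j ∷ J))
    ≡⟨ ∑-splits-∷ (shuffle⊗ g (i ∷ A , B)) j J ⟩
  shuffle⊗ g (i ∷ A , B) ([] , j ∷ J) +
  ∑ (λ (C , D) → shuffle⊗ g (i ∷ A , B) (j ∷ C , D)) (splits J)
    ≡⟨ cong₂ _+_
         (trans (∑-shuffles-[]ʳ column (i ∷ A)) (sym (∑-shuffles-[]ʳ (column ∘ (i ∷_)) A)))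
         (∑-cong (λ (C , D) → ∑-shuffles-∷∷ (λ E → ∑ (g E) (shuffles B D)) i A j C) (splits J)) ⟩
  corner + ∑ (λ CD → left CD + right CD) (splits J)
    ≡⟨ cong (corner +_) (∑-+ left right (splits J)) ⟩
  corner + (∑ left (splits J) + ∑ right (splits J))
    ≡⟨ +-assoc corner (∑ left (splits J)) (∑ right (splits J)) ⟨
  (corner + ∑ left (splits J)) + ∑ right (splits J)
    ≡⟨ cong (_+ ∑ right (splits J)) (∑-splits-∷ (shuffle⊗ (g ∘ (i ∷_)) (A , B)) j J) ⟨
  ∑ (shuffle⊗ (g ∘ (i ∷_)) (A , B)) (splits (j ∷ J)) + ∑ right (splits J) ∎
  where
  column : Composition → ℚ
  column E = ∑ (g E) (shuffles B (j ∷ J))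
  corner = shuffle⊗ (g ∘ (i ∷_)) (A , B) ([] , j ∷ J)
  left right : Composition × Composition → ℚ
  left (C , D) = shuffle⊗ (g ∘ (i ∷_)) (A , B) (j ∷ C , D)
  right = shuffle⊗ (g ∘ (j ∷_)) (i ∷ A , B)

Δ⧢Δ-∷∷ : ∀ g i I j J →
  Δ⧢Δ g (i ∷ I) (j ∷ J) ≡
  ∑ (g []) (shuffles (i ∷ I) (j ∷ J)) +
  (Δ⧢Δ (g ∘ (i ∷_)) I (j ∷ J) + Δ⧢Δ (g ∘ (j ∷_)) (i ∷ I) J)
Δ⧢Δ-∷∷ g i I j J = begin
  Δ⧢Δ g (i ∷ I) (j ∷ J)
    ≡⟨ ∑-splits-∷ (λ AB → ∑ (shuffle⊗ g AB) (splits (j ∷ J))) i I ⟩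
  ∑ (shuffle⊗ g ([] , i ∷ I)) (splits (j ∷ J)) + ∑ otherRow (splits I)
    ≡⟨ cong₂ _+_ firstRow otherRows ⟩
  (sh₀ + lead) + (Δ⧢Δ gᵢ I (j ∷ J) + rest)
    ≡⟨ +-interchange sh₀ lead (Δ⧢Δ gᵢ I (j ∷ J)) rest ⟩
  (sh₀ + Δ⧢Δ gᵢ I (j ∷ J)) + (lead + rest)
    ≡⟨ +-assoc sh₀ (Δ⧢Δ gᵢ I (j ∷ J)) (lead + rest) ⟩
  sh₀ + (Δ⧢Δ gᵢ I (j ∷ J) + (lead + rest))
    ≡⟨ cong (λ x → sh₀ + (Δ⧢Δ gᵢ I (j ∷ J) + x))
            (∑-splits-∷ (λ AB → ∑ (shuffle⊗ gⱼ AB) (splits J)) i I) ⟨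
  sh₀ + (Δ⧢Δ gᵢ I (j ∷ J) + Δ⧢Δ gⱼ (i ∷ I) J) ∎
  where
  gᵢ = g ∘ (i ∷_)
  gⱼ = g ∘ (j ∷_)
  sh₀ = ∑ (g []) (shuffles (i ∷ I) (j ∷ J))
  lead = ∑ (shuffle⊗ gⱼ ([] , i ∷ I)) (splits J)
  restRow : Composition × Composition → ℚ
  restRow (A , B) = ∑ (shuffle⊗ gⱼ (i ∷ A , B)) (splits J)
  rest = ∑ restRow (splits I)
  firstRow : ∑ (shuffle⊗ g ([] , i ∷ I)) (splits (j ∷ J)) ≡ sh₀ + lead
  firstRow = trans (∑-splits-∷ (shuffle⊗ g ([] , i ∷ I)) j J) (cong (_+ lead) (+-identityʳ sh₀))
  otherRow : Composition × Composition → ℚ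
  otherRow (A , B) = ∑ (shuffle⊗ g (i ∷ A , B)) (splits (j ∷ J))
  otherRows : ∑ otherRow (splits I) ≡ Δ⧢Δ gᵢ I (j ∷ J) + rest
  otherRows = trans (∑-cong (λ (A , B) → ∑shuffle⊗-∷ g i A B j J) (splits I))
                    (∑-+ (λ AB → ∑ (shuffle⊗ gᵢ AB) (splits (j ∷ J))) restRow (splits I))

Δ-⧢ : ∀ g I J → ∑ (Δ g) (shuffles I J) ≡ Δ⧢Δ g I J
Δ-⧢ g []      J       = cong (_+ 0ℚ) (sym (∑-cong (shuffle⊗-[]ˡ g) (splits J)))
Δ-⧢ g (i ∷ I) []      = trans (+-identityʳ (Δ g (i ∷ I)))
  (∑-cong (λ AB → sym (trans (+-identityʳ _) (shuffle⊗-[]ʳ g AB))) (splits (i ∷ I)))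
Δ-⧢ g (i ∷ I) (j ∷ J) = begin
  ∑ (Δ g) (shuffles (i ∷ I) (j ∷ J))
    ≡⟨ ∑Δ-shuffles-∷∷ g i I j J ⟩
  sh₀ + (∑ (Δ (g ∘ (i ∷_))) (shuffles I (j ∷ J)) + ∑ (Δ (g ∘ (j ∷_))) (shuffles (i ∷ I) J))
    ≡⟨ cong (sh₀ +_) (cong₂ _+_ (Δ-⧢ (g ∘ (i ∷_)) I (j ∷ J)) (Δ-⧢ (g ∘ (j ∷_)) (i ∷ I) J)) ⟩
  sh₀ + (Δ⧢Δ (g ∘ (i ∷_)) I (j ∷ J) + Δ⧢Δ (g ∘ (j ∷_)) (i ∷ I) J)
    ≡⟨ Δ⧢Δ-∷∷ g i I j J ⟨
  Δ⧢Δ g (i ∷ I) (j ∷ J) ∎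
  where
  sh₀ = ∑ (g []) (shuffles (i ∷ I) (j ∷ J))

ShuffleMultiplicative : (Composition → ℚ) → Set
ShuffleMultiplicative f = ∀ A C → ∑ f (shuffles A C) ≡ f A * f C

nilIndicator : Composition → ℚ
nilIndicator []      = 1ℚ
nilIndicator (_ ∷ _) = 0ℚ

nilIndicator-shuffleMultiplicative : ShuffleMultiplicative nilIndicator
nilIndicator-shuffleMultiplicative []      C       =
  trans (+-identityʳ (nilIndicator C)) (sym (*-identityˡ (nilIndicator C)))
nilIndicator-shuffleMultiplicative (i ∷ A) []      = refl
nilIndicator-shuffleMultiplicative (i ∷ A) (j ∷ C) = trans (∑-shuffles-∷∷ nilIndicator i A j C)
  (cong₂ _+_ (∑-zero (shuffles A (j ∷ C))) (∑-zero (shuffles (i ∷ A) C)))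

-- segmentSum φ lo n I sums, over all ways of cutting I = I₁ ⋯ Iₙ into n
-- possibly empty consecutive pieces, the products ∏ₜ φ Iₜ (lo + t − 1).
segmentSum : (Composition → ℕ → ℚ) → ℕ → ℕ → Composition → ℚ
segmentSum φ lo zero    = nilIndicator
segmentSum φ lo (suc n) = Δ (λ A B → φ A lo * segmentSum φ (suc lo) n B)

segmentSum-shuffleMultiplicative : ∀ φ → (∀ k → ShuffleMultiplicative (λ E → φ E k)) →
  ∀ n lo → ShuffleMultiplicative (segmentSum φ lo n)
segmentSum-shuffleMultiplicative φ φ-mult zero    lo = nilIndicator-shuffleMultiplicative
segmentSum-shuffleMultiplicative φ φ-mult (suc n) lo I J = sym (begin
  S I * S J
    ≡⟨ ∑-*-∑ (uncurry g) (uncurry g) (splits I) (splits J) ⟩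
  ∑ (λ AB → ∑ (λ CD → uncurry g AB * uncurry g CD) (splits J)) (splits I)
    ≡⟨ ∑-cong (λ AB → ∑-cong (g*g≡shuffle⊗ AB) (splits J)) (splits I) ⟩
  Δ⧢Δ g I J
    ≡⟨ Δ-⧢ g I J ⟨
  ∑ S (shuffles I J) ∎)
  where
  S = segmentSum φ lo (suc n)
  S′ = segmentSum φ (suc lo) n
  g : Composition → Composition → ℚ
  g E M = φ E lo * S′ M
  g*g≡shuffle⊗ : ∀ AB CD → uncurry g AB * uncurry g CD ≡ shuffle⊗ g AB CD
  g*g≡shuffle⊗ (A , B) (C , D) = begin
    (φ A lo * S′ B) * (φ C lo * S′ D)
      ≡⟨ *-interchange (φ A lo) (S′ B) (φ C lo) (S′ D) ⟩
    (φ A lo * φ C lo) * (S′ B * S′ D)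
      ≡⟨ cong₂ _*_ (φ-mult lo A C) (segmentSum-shuffleMultiplicative φ φ-mult n (suc lo) B D) ⟨
    ∑ (λ E → φ E lo) (shuffles A C) * ∑ S′ (shuffles B D)
      ≡⟨ ∑-*-∑ (λ E → φ E lo) S′ (shuffles A C) (shuffles B D) ⟩
    shuffle⊗ g (A , B) (C , D) ∎

segmentSum-[] : ∀ φ → (∀ k → φ [] k ≡ 1ℚ) → ∀ n lo → segmentSum φ lo n [] ≡ 1ℚ
segmentSum-[] φ φ[]≡1 zero    lo = refl
segmentSum-[] φ φ[]≡1 (suc n) lo = trans (+-identityʳ (φ [] lo * segmentSum φ (suc lo) n []))
  (trans (cong₂ _*_ (φ[]≡1 lo) (segmentSum-[] φ φ[]≡1 n (suc lo))) (*-identityˡ 1ℚ))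

segmentSum-cong : ∀ {P : ℕ → Set} {φ ψ} → (∀ {E} k → All P E → φ E k ≡ ψ E k) →
  ∀ n lo {I} → All P I → segmentSum φ lo n I ≡ segmentSum ψ lo n I
segmentSum-cong φ≗ψ zero    lo pI = refl
segmentSum-cong {φ = φ} {ψ} φ≗ψ (suc n) lo {I} pI = ∑-cong-All piece (splits-++ I)
  where
  piece : ∀ {AB} → proj₁ AB ++ proj₂ AB ≡ I →
    φ (proj₁ AB) lo * segmentSum φ (suc lo) n (proj₂ AB) ≡
    ψ (proj₁ AB) lo * segmentSum ψ (suc lo) n (proj₂ AB)
  piece {A , B} refl = let pA , pB = All.++⁻ A pI in
    cong₂ _*_ (φ≗ψ lo pA) (segmentSum-cong φ≗ψ n (suc lo) pB)

-- Unlike decompositions, this includes the empty decomposition of [].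
decompositions* : Composition → List (List Composition)
decompositions* []       = [ [] ]
decompositions* (x ∷ xs) = decompositions (x ∷ xs)

-- A copy of the private helper addToFirst of decompositions.
consHead : ℕ → List Composition → List Composition
consHead x []      = [ [ x ] ]
consHead x (P ∷ D) = (x ∷ P) ∷ D

decompositions-∷∷ : ∀ x y ys → decompositions (x ∷ y ∷ ys) ≡
  map (consHead x) (decompositions (y ∷ ys)) ++ map ([ x ] ∷_) (decompositions (y ∷ ys))
decompositions-∷∷ x y ys =
  cong (_++ map ([ x ] ∷_) (decompositions (y ∷ ys)))
       (List.map-cong (λ { [] → refl ; (_ ∷ _) → refl }) (decompositions (y ∷ ys)))

∑-decompositions-∷ : ∀ (f : List Composition → ℚ) x xs → ∑ f (decompositions (x ∷ xs)) ≡
  ∑ (λ (A , B) → ∑ (λ D → f ((x ∷ A) ∷ D)) (decompositions* B)) (splits xs)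
∑-decompositions-∷ f x []       = sym (+-identityʳ (f [ [ x ] ] + 0ℚ))
∑-decompositions-∷ f x (y ∷ ys) = begin
  ∑ f (decompositions (x ∷ y ∷ ys))
    ≡⟨ cong (∑ f) (decompositions-∷∷ x y ys) ⟩
  ∑ f (map (consHead x) Dy ++ map ([ x ] ∷_) Dy)
    ≡⟨ ∑-++ f (map (consHead x) Dy) (map ([ x ] ∷_) Dy) ⟩
  ∑ f (map (consHead x) Dy) + ∑ f (map ([ x ] ∷_) Dy)
    ≡⟨ cong₂ _+_ (∑-map f (consHead x) Dy) (∑-map f ([ x ] ∷_) Dy) ⟩
  ∑ (f ∘ consHead x) Dy + ∑ (λ D → f ([ x ] ∷ D)) Dy
    ≡⟨ cong (_+ ∑ (λ D → f ([ x ] ∷ D)) Dy) (∑-decompositions-∷ (f ∘ consHead x) y ys) ⟩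
  rest + ∑ (λ D → f ([ x ] ∷ D)) Dy
    ≡⟨ +-comm rest _ ⟩
  ∑ (λ D → f ([ x ] ∷ D)) Dy + rest
    ≡⟨ ∑-splits-∷ afterFirst y ys ⟨
  ∑ afterFirst (splits (y ∷ ys)) ∎
  where
  afterFirst : Composition × Composition → ℚ
  afterFirst (A , B) = ∑ (λ D → f ((x ∷ A) ∷ D)) (decompositions* B)
  Dy = decompositions (y ∷ ys)
  rest = ∑ (λ (A , B) → ∑ (λ D → f ((x ∷ y ∷ A) ∷ D)) (decompositions* B)) (splits ys)

assignmentSum : (Composition → ℕ → ℚ) → ℕ → ℕ → List Composition → ℚ
assignmentSum φ lo n D = ∑ (λ ks → prodℚ (zipWith φ D ks)) (incSeqsFrom (length D) lo n)

assignmentSum-∷ : ∀ φ lo n P D → assignmentSum φ lo (suc n) (P ∷ D) ≡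
  φ P lo * assignmentSum φ (suc lo) n D + assignmentSum φ (suc lo) n (P ∷ D)
assignmentSum-∷ φ lo n P D = begin
  ∑ term (map (lo ∷_) K ++ incSeqsFrom (suc (length D)) (suc lo) n)
    ≡⟨ ∑-++ term (map (lo ∷_) K) _ ⟩
  ∑ term (map (lo ∷_) K) + assignmentSum φ (suc lo) n (P ∷ D)
    ≡⟨ cong (_+ assignmentSum φ (suc lo) n (P ∷ D))
            (trans (∑-map term (lo ∷_) K)
                   (sym (*-distribˡ-∑ (φ P lo) (λ ks → prodℚ (zipWith φ D ks)) K))) ⟩
  φ P lo * assignmentSum φ (suc lo) n D + assignmentSum φ (suc lo) n (P ∷ D) ∎
  where
  K = incSeqsFrom (length D) (suc lo) n
  term : List ℕ → ℚ
  term ks = prodℚ (zipWith φ (P ∷ D) ks)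

-- Sorting the chosen indices: the smallest one is either lo, carrying the
-- first piece, or larger than lo.
∑assignmentSum≡segmentSum : ∀ φ → (∀ k → φ [] k ≡ 1ℚ) →
  ∀ n lo I → ∑ (assignmentSum φ lo n) (decompositions* I) ≡ segmentSum φ lo n I
∑assignmentSum≡segmentSum φ φ[]≡1 n       lo []       = sym (segmentSum-[] φ φ[]≡1 n lo)
∑assignmentSum≡segmentSum φ φ[]≡1 zero    lo (x ∷ xs) = begin
  ∑ (assignmentSum φ lo zero) (decompositions (x ∷ xs))
    ≡⟨ ∑-decompositions-∷ (assignmentSum φ lo zero) x xs ⟩
  ∑ (λ (A , B) → ∑ (λ _ → 0ℚ) (decompositions* B)) (splits xs)
    ≡⟨ ∑-cong (λ (A , B) → ∑-zero (decompositions* B)) (splits xs) ⟩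
  ∑ (λ _ → 0ℚ) (splits xs)
    ≡⟨ ∑-zero (splits xs) ⟩
  0ℚ ∎
∑assignmentSum≡segmentSum φ φ[]≡1 (suc n) lo (x ∷ xs) = begin
  ∑ (assignmentSum φ lo (suc n)) (decompositions (x ∷ xs))
    ≡⟨ ∑-decompositions-∷ (assignmentSum φ lo (suc n)) x xs ⟩
  ∑ (λ (A , B) → ∑ (λ D → assignmentSum φ lo (suc n) ((x ∷ A) ∷ D)) (decompositions* B)) (splits xs)
    ≡⟨ ∑-cong smallestIndex (splits xs) ⟩
  ∑ (λ AB → first AB + later AB) (splits xs)
    ≡⟨ ∑-+ first later (splits xs) ⟩
  ∑ first (splits xs) + ∑ later (splits xs)
    ≡⟨ cong₂ _+_ (∑-cong firstPiece (splits xs)) laterPieces ⟩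
  ∑ (λ (A , B) → φ (x ∷ A) lo * S′ B) (splits xs) + S′ (x ∷ xs)
    ≡⟨ +-comm _ (S′ (x ∷ xs)) ⟩
  S′ (x ∷ xs) + ∑ (λ (A , B) → φ (x ∷ A) lo * S′ B) (splits xs)
    ≡⟨ cong (_+ ∑ (λ (A , B) → φ (x ∷ A) lo * S′ B) (splits xs))
            (trans (cong (_* S′ (x ∷ xs)) (φ[]≡1 lo)) (*-identityˡ (S′ (x ∷ xs)))) ⟨
  φ [] lo * S′ (x ∷ xs) + ∑ (λ (A , B) → φ (x ∷ A) lo * S′ B) (splits xs)
    ≡⟨ ∑-splits-∷ (λ (A , B) → φ A lo * S′ B) x xs ⟨
  segmentSum φ lo (suc n) (x ∷ xs) ∎
  where
  a′ = assignmentSum φ (suc lo) n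
  S′ = segmentSum φ (suc lo) n
  first later : Composition × Composition → ℚ
  first (A , B) = ∑ (λ D → φ (x ∷ A) lo * a′ D) (decompositions* B)
  later (A , B) = ∑ (λ D → a′ ((x ∷ A) ∷ D)) (decompositions* B)
  smallestIndex : ∀ AB →
    ∑ (λ D → assignmentSum φ lo (suc n) ((x ∷ proj₁ AB) ∷ D)) (decompositions* (proj₂ AB)) ≡
    first AB + later AB
  smallestIndex (A , B) = trans (∑-cong (assignmentSum-∷ φ lo n (x ∷ A)) (decompositions* B))
    (∑-+ (λ D → φ (x ∷ A) lo * a′ D) (λ D → a′ ((x ∷ A) ∷ D)) (decompositions* B))
  firstPiece : ∀ AB → first AB ≡ φ (x ∷ proj₁ AB) lo * S′ (proj₂ AB)
  firstPiece (A , B) = trans (sym (*-distribˡ-∑ (φ (x ∷ A) lo) a′ (decompositions* B)))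
    (cong (φ (x ∷ A) lo *_) (∑assignmentSum≡segmentSum φ φ[]≡1 n (suc lo) B))
  laterPieces : ∑ later (splits xs) ≡ S′ (x ∷ xs)
  laterPieces = trans (sym (∑-decompositions-∷ a′ x xs))
                      (∑assignmentSum≡segmentSum φ φ[]≡1 n (suc lo) (x ∷ xs))

-- The weight of a piece

monomial : ℚ → ℚ → ℕ → ℕ → ℚ
monomial a b l e = powℚ a l * powℚ b e * 1/ l !

monomial-binomial : ∀ a b N l m e f → N ℕ.* (l ! ℕ.* m !) ≡ (l ℕ.+ m) ! →
  ι N * monomial a b (l ℕ.+ m) (e ℕ.+ f) ≡ monomial a b l e * monomial a b m f
monomial-binomial a b N l m e f N*l!*m!≡[l+m]! = begin
  ι N * (powℚ a (l ℕ.+ m) * powℚ b (e ℕ.+ f) * 1/ (l ℕ.+ m) !)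
    ≡⟨ cong₂ (λ x y → ι N * (x * y * 1/ (l ℕ.+ m) !)) (powℚ-+ a l m) (powℚ-+ b e f) ⟩
  ι N * ((powℚ a l * powℚ a m) * (powℚ b e * powℚ b f) * 1/ (l ℕ.+ m) !)
    ≡⟨ regroup (ι N) (powℚ a l) (powℚ a m) (powℚ b e) (powℚ b f) (1/ (l ℕ.+ m) !) ⟩
  (powℚ a l * powℚ b e) * (powℚ a m * powℚ b f) * (ι N * 1/ (l ℕ.+ m) !)
    ≡⟨ cong ((powℚ a l * powℚ b e) * (powℚ a m * powℚ b f) *_)
            (1/[l+m]!-binomial N l m N*l!*m!≡[l+m]!) ⟩
  (powℚ a l * powℚ b e) * (powℚ a m * powℚ b f) * (1/ l ! * 1/ m !)
    ≡⟨ *-interchange (powℚ a l * powℚ b e) (powℚ a m * powℚ b f) (1/ l !) (1/ m !) ⟩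
  monomial a b l e * monomial a b m f ∎
  where
  regroup : ∀ n x x′ y y′ r → n * ((x * x′) * (y * y′) * r) ≡ (x * y) * (x′ * y′) * (n * r)
  regroup = solve-∀ ℚ-ring

-- |E| − ℓ(E), written as a sum over the parts so that it is additive under
-- shuffles whatever the parts are.
excess : Composition → ℕ
excess E = sum (map (_∸ 1) E)

excess-↭ : ∀ {E A C} → E ↭ A ++ C → excess E ≡ excess A ℕ.+ excess C
excess-↭ {A = A} {C} E↭A++C = trans (sum-↭ (map⁺ (_∸ 1) E↭A++C))
  (trans (cong sum (List.map-++ (_∸ 1) A C)) (sum-++ (map (_∸ 1) A) (map (_∸ 1) C)))

length-↭ : ∀ {E A C : Composition} → E ↭ A ++ C → length E ≡ length A ℕ.+ length C
length-↭ {A = A} E↭A++C = trans (↭-length E↭A++C) (List.length-++ A)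

weight : ℚ → ℚ → Composition → ℚ
weight a b E = monomial a b (length E) (excess E)

weight-shuffleMultiplicative : ∀ a b → ShuffleMultiplicative (weight a b)
weight-shuffleMultiplicative a b A C = begin
  ∑ (weight a b) (shuffles A C)
    ≡⟨ ∑-cong-All (λ E↭ → cong₂ (monomial a b) (length-↭ {A = A} {C} E↭) (excess-↭ {A = A} {C} E↭))
                  (shuffles-↭ A C) ⟩
  ∑ (λ _ → mAC) (shuffles A C)
    ≡⟨ ∑-const mAC (shuffles A C) ⟩
  ι (length (shuffles A C)) * mAC
    ≡⟨ monomial-binomial a b _ (length A) (length C) (excess A) (excess C) (length-shuffles A C) ⟩
  weight a b A * weight a b C ∎
  where
  mAC = monomial a b (length A ℕ.+ length C) (excess A ℕ.+ excess C)

size≡excess+length : ∀ {P} → All (1 ≤_) P → size P ≡ excess P ℕ.+ length P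
size≡excess+length []                          = refl
size≡excess+length {suc x ∷ P} (s≤s z≤n ∷ pos) =
  trans (cong (suc x ℕ.+_) (size≡excess+length pos)) (regroup x (excess P) (length P))
  where
  regroup : ∀ x e l → suc x ℕ.+ (e ℕ.+ l) ≡ x ℕ.+ e ℕ.+ suc l
  regroup = ℕ-solve-∀

factor≡weight : ∀ d p q {P} k → All (1 ≤_) P → factor d p q P k ≡ weight (p k) (q′ d q k) P
factor≡weight d p q {P} k pos = cong (monomial (p k) (q′ d q k) (length P))
  (trans (cong (_∸ length P) (size≡excess+length pos)) (ℕₚ.m+n∸n≡m (excess P) (length P)))

H≡segmentSum : ∀ d p q {K} → All (1 ≤_) K → K ≢ [] →
  H d p q K ≡ segmentSum (λ E k → weight (p k) (q′ d q k) E) 1 d K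
H≡segmentSum d p q {[]}     _   []≢[] = contradiction refl []≢[]
H≡segmentSum d p q {x ∷ xs} pos _     = begin
  H d p q (x ∷ xs)
    ≡⟨ sumℚ-concatMap _ (decompositions (x ∷ xs)) ⟩
  ∑ (assignmentSum (factor d p q) 1 d) (decompositions* (x ∷ xs))
    ≡⟨ ∑assignmentSum≡segmentSum (factor d p q) (λ _ → refl) d 1 (x ∷ xs) ⟩
  segmentSum (factor d p q) 1 d (x ∷ xs)
    ≡⟨ segmentSum-cong (factor≡weight d p q) d 1 pos ⟩
  segmentSum (λ E k → weight (p k) (q′ d q k) E) 1 d (x ∷ xs) ∎

++[x]≢[] : ∀ (xs : Composition) x → xs ++ [ x ] ≢ []
++[x]≢[] []      x ()
++[x]≢[] (_ ∷ _) x ()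

proposition4p7 : (I J : Composition) →
    All (1 ≤_) I → All (1 ≤_) J →
    Σ Composition (λ I₀ → Σ ℕ (λ a → I ≡ I₀ ++ [ a ] × 1 < a)) →
    Σ Composition (λ J₀ → Σ ℕ (λ b → J ≡ J₀ ++ [ b ] × 1 < b)) →
    (d : ℕ) (p q : ℕ → ℚ) →
    H d p q I * H d p q J ≡ sumℚ (map (H d p q) (shuffles I J))
proposition4p7 I J pI pJ (I₀ , a , refl , _) (J₀ , b , refl , _) d p q = begin
  H d p q I * H d p q J
    ≡⟨ cong₂ _*_ (H≡segmentSum d p q pI (++[x]≢[] I₀ a))
                 (H≡segmentSum d p q pJ (++[x]≢[] J₀ b)) ⟩
  S I * S J
    ≡⟨ segmentSum-shuffleMultiplicative φ (λ k → weight-shuffleMultiplicative (p k) (q′ d q k))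
                                          d 1 I J ⟨
  ∑ S (shuffles I J)
    ≡⟨ ∑-cong-All (λ (pos , ≢[]) → H≡segmentSum d p q pos ≢[])
                  (All.zip (shuffles-All pI pJ , shuffles-≢[] J (++[x]≢[] I₀ a))) ⟨
  sumℚ (map (H d p q) (shuffles I J)) ∎
  where
  φ : Composition → ℕ → ℚ
  φ E k = weight (p k) (q′ d q k) E
  S = segmentSum φ 1 d
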